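{- If $G=(V_1\cup V_2,E)$ is a simple, connected, biregular bipartite, edge-rigid graph with at least one edge, then $G$ is walk-biregular.
   Context: $V_1,V_2$ are the parts of the bipartition; vertices in $V_1$ have degree $d_1$ and vertices in $V_2$ degree $d_2$. Laplacian $L=\sum_{ab\in E}(e_a-e_b)(e_a-e_b)^T$; $\mathcal{L}^*(X)_{ab}=X_{aa}+X_{bb}-2X_{ab}$ for symmetric $X$. With spectral decomposition $L=\sum_{i=1}^r\lambda_iE_i$ (distinct eigenvalues $0=\lambda_1<\dots<\lambda_r$, orthogonal eigenprojectors $E_i$), $G$ is edge-rigid if for each $i\in\{2,\dots,r\}$ there is $\gamma_i>0$ with $\mathcal{L}^*(E_i)=\gamma_i\mathbf{1}$. $G$ is walk-biregular if for every $\ell\ge0$ there are constants $\alpha_\ell^{(1)},\alpha_\ell^{(2)}$ such that the number of closed walks of length $\ell$ starting at any $a\in V_1$ is $\alpha^{(1)}_\ell$ and at any $b\in V_2$ is $\alpha^{(2)}_\ell$. -}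

module Defs where

open import Level using (Level; _⊔_)
open import Algebra.Bundles using (CommutativeRing)
open import Data.Nat as ℕ using (ℕ; zero; suc)
open import Data.Fin using (Fin; toℕ)
open import Data.Fin.Properties using (_≟_)
open import Data.Bool using (Bool; true; false; if_then_else_; T)
open import Data.Product using (Σ; ∃; _×_; _,_)
open import Data.Sum using (_⊎_)
open import Relation.Nullary using (¬_; yes; no)
open import Relation.Binary.PropositionalEquality using (_≡_; _≢_)

record OrderedField (c ℓ : Level) : Set (Level.suc (c ⊔ ℓ)) where
  field
    commRing : CommutativeRing c ℓ
  open CommutativeRing commRing public
  field
    _<_        : Carrier → Carrier → Set ℓ
    <-irrefl   : ∀ {x y} → x ≈ y → ¬ (x < y)
    <-trans    : ∀ {x y z} → x < y → y < z → x < z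
    <-tri      : ∀ x y → x < y ⊎ (x ≈ y ⊎ y < x)
    <-resp-≈   : ∀ {x x′ y y′} → x ≈ x′ → y ≈ y′ → x < y → x′ < y′
    +-mono-<   : ∀ {x y} z → x < y → (x + z) < (y + z)
    *-pos      : ∀ {x y} → 0# < x → 0# < y → 0# < (x * y)
    0≉1        : ¬ (0# ≈ 1#)
    inverse    : ∀ x → ¬ (x ≈ 0#) → Σ Carrier (λ y → (x * y) ≈ 1#)

sumℕ : ∀ {n} → (Fin n → ℕ) → ℕ
sumℕ {zero}  f = 0
sumℕ {suc n} f = f Fin.zero ℕ.+ sumℕ (λ i → f (Fin.suc i))
  where import Data.Fin as Fin

module _ {c ℓ} (F : OrderedField c ℓ) where
  open OrderedField F

  sumF : ∀ {n} → (Fin n → Carrier) → Carrier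
  sumF {zero}  f = 0#
  sumF {suc n} f = f Fin.zero + sumF (λ i → f (Fin.suc i))
    where import Data.Fin as Fin

  fromℕ : ℕ → Carrier
  fromℕ zero    = 0#
  fromℕ (suc k) = 1# + fromℕ k

record Graph (n : ℕ) : Set where
  field
    adj       : Fin n → Fin n → Bool
    adj-sym   : ∀ a b → adj a b ≡ adj b a
    adj-irr   : ∀ a → adj a a ≡ false
open Graph public

Adj : ∀ {n} → Graph n → Fin n → Fin n → Set
Adj G a b = T (adj G a b)

adjℕ : ∀ {n} → Graph n → Fin n → Fin n → ℕ
adjℕ G a b = if adj G a b then 1 else 0

degree : ∀ {n} → Graph n → Fin n → ℕ
degree G a = sumℕ (adjℕ G a)

data Walk {n} (G : Graph n) : ℕ → Fin n → Fin n → Set where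
  here : ∀ {a} → Walk G 0 a a
  step : ∀ {ℓ a b c} → Adj G a b → Walk G ℓ b c → Walk G (suc ℓ) a c

Connected : ∀ {n} → Graph n → Set
Connected G = ∀ a b → ∃ λ ℓ → Walk G ℓ a b

HasEdge : ∀ {n} → Graph n → Set
HasEdge G = ∃ λ a → ∃ λ b → Adj G a b

numWalks : ∀ {n} → Graph n → ℕ → Fin n → Fin n → ℕ
numWalks G zero    a b with a ≟ b
... | yes _ = 1
... | no  _ = 0
numWalks G (suc ℓ) a b = sumℕ (λ c → adjℕ G a c ℕ.* numWalks G ℓ c b)

closedWalks : ∀ {n} → Graph n → ℕ → Fin n → ℕ
closedWalks G ℓ a = numWalks G ℓ a a

-- Bipartition: part a ≡ false means a ∈ V₁, part a ≡ true means a ∈ V₂.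
Bipartition : ∀ {n} → Graph n → (Fin n → Bool) → Set
Bipartition G part = ∀ a b → Adj G a b → part a ≢ part b

Biregular : ∀ {n} → Graph n → (Fin n → Bool) → ℕ → ℕ → Set
Biregular G part d₁ d₂ =
  (∀ a → part a ≡ false → degree G a ≡ d₁) ×
  (∀ a → part a ≡ true  → degree G a ≡ d₂)

WalkBiregular : ∀ {n} → Graph n → (Fin n → Bool) → Set
WalkBiregular G part = ∀ ℓ → ∃ λ α₁ → ∃ λ α₂ →
  (∀ a → part a ≡ false → closedWalks G ℓ a ≡ α₁) ×
  (∀ b → part b ≡ true  → closedWalks G ℓ b ≡ α₂)

module _ {c ℓ} (F : OrderedField c ℓ) where
  open OrderedField F

  Matrix : ℕ → Set c
  Matrix n = Fin n → Fin n → Carrier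

  _≈M_ : ∀ {n} → Matrix n → Matrix n → Set ℓ
  X ≈M Y = ∀ a b → X a b ≈ Y a b

  _·M_ : ∀ {n} → Matrix n → Matrix n → Matrix n
  (X ·M Y) a b = sumF F (λ k → X a k * Y k b)

  idM : ∀ {n} → Matrix n
  idM a b with a ≟ b
  ... | yes _ = 1#
  ... | no  _ = 0#

  zeroM : ∀ {n} → Matrix n
  zeroM a b = 0#

  Symmetric : ∀ {n} → Matrix n → Set ℓ
  Symmetric X = ∀ a b → X a b ≈ X b a

  -- Laplacian L = Σ_{ab ∈ E} (e_a - e_b)(e_a - e_b)^T = D - A
  laplacian : ∀ {n} → Graph n → Matrix n
  laplacian G a b with a ≟ b
  ... | yes _ = fromℕ F (degree G a)
  ... | no  _ = if adj G a b then - 1# else 0#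

  Lstar : ∀ {n} → Matrix n → Fin n → Fin n → Carrier
  Lstar X a b = X a a + X b b - (1# + 1#) * X a b

  -- Spectral decomposition L = Σ_{i<r} λ_i E_i with distinct eigenvalues
  -- 0 = λ_0 < λ_1 < … < λ_{r-1} (0-indexed) and orthogonal eigenprojectors E_i.
  record SpectralDecomposition {n} (L : Matrix n) : Set (c ⊔ ℓ) where
    field
      r        : ℕ
      eigval   : Fin r → Carrier
      proj     : Fin r → Matrix n
      increasing : ∀ i j → toℕ i ℕ.< toℕ j → eigval i < eigval j
      first-zero : ∀ i → toℕ i ≡ 0 → eigval i ≈ 0#
      proj-sym   : ∀ i → Symmetric (proj i)
      proj-idem  : ∀ i → (proj i ·M proj i) ≈M proj i
      proj-orth  : ∀ i j → i ≢ j → (proj i ·M proj j) ≈M zeroM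
      proj-nonzero : ∀ i → ¬ (proj i ≈M zeroM)
      proj-sum   : (λ a b → sumF F (λ i → proj i a b)) ≈M idM
      decomp     : L ≈M (λ a b → sumF F (λ i → eigval i * proj i a b))

  -- Edge-rigidity with respect to a spectral decomposition of the Laplacian:
  -- for every i ≠ 0 (i.e. λ_i ≠ 0) there is γ_i > 0 with 𝓛*(E_i) = γ_i 𝟏
  -- (the all-ones vector indexed by the edges).
  EdgeRigid : ∀ {n} (G : Graph n) → SpectralDecomposition (laplacian G) → Set (c ⊔ ℓ)
  EdgeRigid G S = ∀ i → toℕ i ≢ 0 → Σ Carrier λ γ → (0# < γ) ×
    (∀ a b → Adj G a b → Lstar (proj i) a b ≈ γ)
    where open SpectralDecomposition S

{-# OPTIONS --safe #-}
module Submission where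

-- Let E be an eigenprojector of L = D - A with eigenvalue θ. Then A E = (D - θ) E, and since A
-- swaps the two sides of the bipartition while D is constant on each side,
-- A² E = (d₁ - θ)(d₂ - θ) E. Hence A^{2k} = Σⱼ μⱼᵏ Eⱼ with μⱼ = (d₁ - θⱼ)(d₂ - θⱼ). At an edge ab
-- the entry (A^{2k})_{ab} vanishes, so applying 𝓛* gives
-- (A^{2k})_{aa} + (A^{2k})_{bb} = Σⱼ μⱼᵏ 𝓛*(Eⱼ)_{ab}, which edge-rigidity makes independent of the
-- edge. In a connected bipartite graph a function whose sums along edges are constant is constant
-- on each side, and there are no closed walks of odd length. Walk counts are compared through
-- their images in the ordered field, which has characteristic 0.

open import Defs
open import Level using (Level; _⊔_)
open import Data.Nat using (ℕ)
open import Data.Bool using (Bool)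
open import Data.Fin using (Fin)

open import Algebra.Bundles using (AbelianGroup; CommutativeRing)
open import Data.Bool using (true; false; not; T)
open import Data.Bool.Properties using (¬-not; not-¬) renaming (_≟_ to _≟ᴮ_)
open import Data.Empty using (⊥-elim)
open import Data.Fin using (zero; suc)
open import Data.Fin.Properties using (_≟_; punchInᵢ≢i)
open import Data.Nat as ℕ using (zero; suc)
import Data.Nat.Properties as ℕ
open import Data.Product using (∃; _×_; _,_; proj₁; proj₂)
open import Data.Sum using (inj₁; inj₂)
open import Data.Unit using (tt)
open import Data.Vec.Functional using (removeAt)
open import Function using (_∘_)
open import Relation.Nullary using (yes; no)
open import Relation.Binary.PropositionalEquality as ≡ using (_≡_; _≢_)

module Matrices {c ℓ} (R : CommutativeRing c ℓ) where
  open CommutativeRing R hiding (zero)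
  open import Algebra.Properties.AbelianGroup +-abelianGroup using (⁻¹-∙-comm)
  open import Algebra.Properties.Group +-group using (ε⁻¹≈ε)
  open import Algebra.Properties.CommutativeSemigroup *-commutativeSemigroup
    using (x∙yz≈y∙xz)
  open import Algebra.Properties.Semiring.Sum semiring public
    using (sum; sum-cong-≋; ∑-distrib-+; ∑-comm; *-distribˡ-sum; *-distribʳ-sum)
  open import Algebra.Properties.Semiring.Sum semiring
    using (sum-remove; sum-replicate-zero)
  open import Relation.Binary.Reasoning.Setoid setoid

  sum-neg : ∀ {n} (f : Fin n → Carrier) → sum (λ i → - f i) ≈ - sum f
  sum-neg {zero}  f = sym ε⁻¹≈ε
  sum-neg {suc n} f = trans (+-congˡ (sum-neg (f ∘ suc))) (⁻¹-∙-comm (f zero) (sum (f ∘ suc)))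

  sum-sub : ∀ {n} (f g : Fin n → Carrier) → sum (λ i → f i - g i) ≈ sum f - sum g
  sum-sub f g = trans (∑-distrib-+ f (λ i → - g i)) (+-congˡ (sum-neg g))

  sum-zero : ∀ {n} {f : Fin n → Carrier} → (∀ i → f i ≈ 0#) → sum f ≈ 0#
  sum-zero {n} f≈0 = trans (sum-cong-≋ f≈0) (sum-replicate-zero n)

  sum-single : ∀ {n} (i : Fin n) (f : Fin n → Carrier) → (∀ j → j ≢ i → f j ≈ 0#) → sum f ≈ f i
  sum-single {suc n} i f f≈0 = begin
    sum f                    ≈⟨ sum-remove {i = i} f ⟩
    f i + sum (removeAt f i) ≈⟨ +-congˡ (sum-zero (λ j → f≈0 _ (punchInᵢ≢i i j))) ⟩
    f i + 0#                 ≈⟨ +-identityʳ (f i) ⟩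
    f i                      ∎

  SquareMatrix : ℕ → Set c
  SquareMatrix n = Fin n → Fin n → Carrier

  infix  4 _≈ᴹ_
  infixl 7 _*ᴹ_
  infixr 7 _•ᴹ_

  _≈ᴹ_ : ∀ {n} → SquareMatrix n → SquareMatrix n → Set ℓ
  X ≈ᴹ Y = ∀ a b → X a b ≈ Y a b

  _*ᴹ_ : ∀ {n} → SquareMatrix n → SquareMatrix n → SquareMatrix n
  (X *ᴹ Y) a b = sum (λ k → X a k * Y k b)

  _•ᴹ_ : ∀ {n} → Carrier → SquareMatrix n → SquareMatrix n
  (x •ᴹ X) a b = x * X a b

  combination : ∀ {r n} → (Fin r → Carrier) → (Fin r → SquareMatrix n) → SquareMatrix n
  combination x X a b = sum (λ j → (x j •ᴹ X j) a b)

  *ᴹ-congˡ : ∀ {n} {X X′ : SquareMatrix n} (Y : SquareMatrix n) → X ≈ᴹ X′ → X *ᴹ Y ≈ᴹ X′ *ᴹ Y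
  *ᴹ-congˡ Y X≈X′ a b = sum-cong-≋ (λ k → *-congʳ (X≈X′ a k))

  *ᴹ-congʳ : ∀ {n} (X : SquareMatrix n) {Y Y′ : SquareMatrix n} → Y ≈ᴹ Y′ → X *ᴹ Y ≈ᴹ X *ᴹ Y′
  *ᴹ-congʳ X Y≈Y′ a b = sum-cong-≋ (λ k → *-congˡ (Y≈Y′ k b))

  *ᴹ-distribˡ-combination : ∀ {r n} (X : SquareMatrix n) (x : Fin r → Carrier) Y →
                            X *ᴹ combination x Y ≈ᴹ combination x (λ j → X *ᴹ Y j)
  *ᴹ-distribˡ-combination X x Y a b = begin
    sum (λ k → X a k * sum (λ j → x j * Y j k b))
      ≈⟨ sum-cong-≋ (λ k → *-distribˡ-sum (X a k) (λ j → x j * Y j k b)) ⟩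
    sum (λ k → sum (λ j → X a k * (x j * Y j k b)))
      ≈⟨ ∑-comm (λ k j → X a k * (x j * Y j k b)) ⟩
    sum (λ j → sum (λ k → X a k * (x j * Y j k b)))
      ≈⟨ sum-cong-≋ (λ j → sum-cong-≋ (λ k → x∙yz≈y∙xz (X a k) (x j) (Y j k b))) ⟩
    sum (λ j → sum (λ k → x j * (X a k * Y j k b)))
      ≈⟨ sum-cong-≋ (λ j → *-distribˡ-sum (x j) (λ k → X a k * Y j k b)) ⟨
    sum (λ j → x j * sum (λ k → X a k * Y j k b))   ∎

  *ᴹ-distribʳ-combination : ∀ {r n} (x : Fin r → Carrier) X (Y : SquareMatrix n) →
                            combination x X *ᴹ Y ≈ᴹ combination x (λ j → X j *ᴹ Y)
  *ᴹ-distribʳ-combination x X Y a b = begin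
    sum (λ k → sum (λ j → x j * X j a k) * Y k b)
      ≈⟨ sum-cong-≋ (λ k → *-distribʳ-sum (Y k b) (λ j → x j * X j a k)) ⟩
    sum (λ k → sum (λ j → (x j * X j a k) * Y k b))
      ≈⟨ ∑-comm (λ k j → (x j * X j a k) * Y k b) ⟩
    sum (λ j → sum (λ k → (x j * X j a k) * Y k b))
      ≈⟨ sum-cong-≋ (λ j → sum-cong-≋ (λ k → *-assoc (x j) (X j a k) (Y k b))) ⟩
    sum (λ j → sum (λ k → x j * (X j a k * Y k b)))
      ≈⟨ sum-cong-≋ (λ j → *-distribˡ-sum (x j) (λ k → X j a k * Y k b)) ⟨
    sum (λ j → x j * sum (λ k → X j a k * Y k b))   ∎

  combination-*ᴹ-orthogonal : ∀ {r n} {E : Fin r → SquareMatrix n} →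
    (∀ i → E i *ᴹ E i ≈ᴹ E i) → (∀ i j → i ≢ j → E i *ᴹ E j ≈ᴹ (λ _ _ → 0#)) →
    ∀ x j → combination x E *ᴹ E j ≈ᴹ x j •ᴹ E j
  combination-*ᴹ-orthogonal {E = E} idem orth x j a b = begin
    (combination x E *ᴹ E j) a b ≈⟨ *ᴹ-distribʳ-combination x E (E j) a b ⟩
    sum (λ i → x i * (E i *ᴹ E j) a b)
      ≈⟨ sum-single j _ (λ i i≢j → trans (*-congˡ (orth i j i≢j a b)) (zeroʳ (x i))) ⟩
    x j * (E j *ᴹ E j) a b ≈⟨ *-congˡ (idem j a b) ⟩
    x j * E j a b ∎

module OrderedFieldProperties {c ℓ} (F : OrderedField c ℓ) where
  open OrderedField F hiding (zero)
  open Matrices commRing using (sum)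
  open import Algebra.Properties.Ring ring using (-1*x≈-x)
  open import Algebra.Properties.Group +-group using (⁻¹-involutive; ∙-cancelˡ)
  open import Relation.Binary.Reasoning.Setoid setoid

  fromℕ-+ : ∀ m n → fromℕ F (m ℕ.+ n) ≈ fromℕ F m + fromℕ F n
  fromℕ-+ zero    n = sym (+-identityˡ (fromℕ F n))
  fromℕ-+ (suc m) n = trans (+-congˡ (fromℕ-+ m n)) (sym (+-assoc 1# (fromℕ F m) (fromℕ F n)))

  fromℕ-* : ∀ m n → fromℕ F (m ℕ.* n) ≈ fromℕ F m * fromℕ F n
  fromℕ-* zero    n = sym (zeroˡ (fromℕ F n))
  fromℕ-* (suc m) n = begin
    fromℕ F (n ℕ.+ m ℕ.* n)
      ≈⟨ fromℕ-+ n (m ℕ.* n) ⟩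
    fromℕ F n + fromℕ F (m ℕ.* n)
      ≈⟨ +-cong (sym (*-identityˡ (fromℕ F n))) (fromℕ-* m n) ⟩
    1# * fromℕ F n + fromℕ F m * fromℕ F n
      ≈⟨ distribʳ (fromℕ F n) 1# (fromℕ F m) ⟨
    (1# + fromℕ F m) * fromℕ F n ∎

  fromℕ-sumℕ : ∀ {n} (f : Fin n → ℕ) → fromℕ F (sumℕ f) ≈ sum (fromℕ F ∘ f)
  fromℕ-sumℕ {zero}  f = refl
  fromℕ-sumℕ {suc n} f = trans (fromℕ-+ (f zero) (sumℕ (f ∘ suc))) (+-congˡ (fromℕ-sumℕ (f ∘ suc)))

  0<1 : 0# < 1#
  0<1 with <-tri 0# 1#
  ... | inj₁ 0<1        = 0<1
  ... | inj₂ (inj₁ 0≈1) = ⊥-elim (0≉1 0≈1)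
  ... | inj₂ (inj₂ 1<0) = ⊥-elim (<-irrefl refl (<-trans 0<1′ 1<0))
    where
    0<-1 : 0# < (- 1#)
    0<-1 = <-resp-≈ (-‿inverseʳ 1#) (+-identityˡ (- 1#)) (+-mono-< (- 1#) 1<0)
    0<1′ : 0# < 1#
    0<1′ = <-resp-≈ refl (trans (-1*x≈-x (- 1#)) (⁻¹-involutive 1#)) (*-pos 0<-1 0<-1)

  0<1+x : ∀ {x} → 0# < x → 0# < (1# + x)
  0<1+x {x} 0<x = <-trans 0<1 (<-resp-≈ (+-identityˡ 1#) (+-comm x 1#) (+-mono-< 1# 0<x))

  0<fromℕ-suc : ∀ k → 0# < fromℕ F (suc k)
  0<fromℕ-suc zero    = <-resp-≈ refl (sym (+-identityʳ 1#)) 0<1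
  0<fromℕ-suc (suc k) = 0<1+x (0<fromℕ-suc k)

  fromℕ-injective : ∀ {m n} → fromℕ F m ≈ fromℕ F n → m ≡ n
  fromℕ-injective {zero}  {zero}  _ = ≡.refl
  fromℕ-injective {zero}  {suc n} 0≈n = ⊥-elim (<-irrefl 0≈n (0<fromℕ-suc n))
  fromℕ-injective {suc m} {zero}  m≈0 = ⊥-elim (<-irrefl (sym m≈0) (0<fromℕ-suc m))
  fromℕ-injective {suc m} {suc n} m≈n = ≡.cong suc (fromℕ-injective (∙-cancelˡ 1# _ _ m≈n))

module FieldMatrices {c ℓ} (F : OrderedField c ℓ) where
  open OrderedField F hiding (zero)
  open Matrices commRing
  open import Algebra.Properties.Ring ring using (x[y-z]≈xy-xz)
  open import Algebra.Properties.Group +-group using (loop)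
  open import Algebra.Properties.Loop loop using (x//ε≈x)
  open import Algebra.Properties.CommutativeSemigroup *-commutativeSemigroup
    using (x∙yz≈y∙xz)
  open import Relation.Binary.Reasoning.Setoid setoid

  sumF≡sum : ∀ {n} (f : Fin n → Carrier) → sumF F f ≡ sum f
  sumF≡sum {zero}  f = ≡.refl
  sumF≡sum {suc n} f = ≡.cong (f zero +_) (sumF≡sum (f ∘ suc))

  *ᴹ≡·M : ∀ {n} (X Y : Matrix F n) a b → (X *ᴹ Y) a b ≡ (_·M_ F X Y) a b
  *ᴹ≡·M X Y a b = ≡.sym (sumF≡sum (λ k → X a k * Y k b))

  idM-diagonal : ∀ {n} (a : Fin n) → idM F a a ≈ 1#
  idM-diagonal a with a ≟ a
  ... | yes _   = refl
  ... | no  a≢a = ⊥-elim (a≢a ≡.refl)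

  idM-offDiagonal : ∀ {n} {a b : Fin n} → a ≢ b → idM F a b ≈ 0#
  idM-offDiagonal {a = a} {b} a≢b with a ≟ b
  ... | yes a≡b = ⊥-elim (a≢b a≡b)
  ... | no  _   = refl

  Lstar-cong : ∀ {n} {X Y : Matrix F n} → X ≈ᴹ Y → ∀ a b → Lstar F X a b ≈ Lstar F Y a b
  Lstar-cong X≈Y a b = +-cong (+-cong (X≈Y a a) (X≈Y b b)) (-‿cong (*-congˡ (X≈Y a b)))

  Lstar-sum : ∀ {r n} (X : Fin r → Matrix F n) a b →
              Lstar F (λ u v → sum (λ j → X j u v)) a b ≈ sum (λ j → Lstar F (X j) a b)
  Lstar-sum X a b = begin
    sum (λ j → X j a a) + sum (λ j → X j b b) - (1# + 1#) * sum (λ j → X j a b)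
      ≈⟨ +-cong (sym (∑-distrib-+ (λ j → X j a a) (λ j → X j b b)))
                (-‿cong (*-distribˡ-sum (1# + 1#) (λ j → X j a b))) ⟩
    sum (λ j → X j a a + X j b b) - sum (λ j → (1# + 1#) * X j a b)
      ≈⟨ sum-sub (λ j → X j a a + X j b b) (λ j → (1# + 1#) * X j a b) ⟨
    sum (λ j → Lstar F (X j) a b) ∎

  Lstar-• : ∀ {n} x (X : Matrix F n) a b → Lstar F (x •ᴹ X) a b ≈ x * Lstar F X a b
  Lstar-• x X a b = begin
    x * X a a + x * X b b - (1# + 1#) * (x * X a b)
      ≈⟨ +-cong (distribˡ x (X a a) (X b b)) (-‿cong (x∙yz≈y∙xz x (1# + 1#) (X a b))) ⟨
    x * (X a a + X b b) - x * ((1# + 1#) * X a b)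
      ≈⟨ x[y-z]≈xy-xz x (X a a + X b b) ((1# + 1#) * X a b) ⟨
    x * Lstar F X a b ∎

  Lstar-combination : ∀ {r n} x (X : Fin r → Matrix F n) a b →
                      Lstar F (combination x X) a b ≈ sum (λ j → x j * Lstar F (X j) a b)
  Lstar-combination x X a b = trans (Lstar-sum (λ j → x j •ᴹ X j) a b)
                                    (sum-cong-≋ (λ j → Lstar-• (x j) (X j) a b))

  Lstar-zero-entry : ∀ {n} (X : Matrix F n) {a b} → X a b ≈ 0# → Lstar F X a b ≈ X a a + X b b
  Lstar-zero-entry X {a} {b} Xab≈0 =
    trans (+-congˡ (-‿cong (trans (*-congˡ Xab≈0) (zeroʳ (1# + 1#))))) (x//ε≈x (X a a + X b b))

  Lstar-idM : ∀ {n} {a b : Fin n} → a ≢ b → Lstar F (idM F) a b ≈ 1# + 1#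
  Lstar-idM {a = a} {b} a≢b = trans (Lstar-zero-entry (idM F) {a} {b} (idM-offDiagonal a≢b))
                                    (+-cong (idM-diagonal a) (idM-diagonal b))

module SpectralDecompositionProperties {c ℓ} (F : OrderedField c ℓ) {n} {L : Matrix F n}
                                       (S : SpectralDecomposition F L) where
  open OrderedField F hiding (zero)
  open Matrices commRing
  open FieldMatrices F
  open SpectralDecomposition S
  open import Relation.Binary.Reasoning.Setoid setoid

  proj-idempotent : ∀ i → proj i *ᴹ proj i ≈ᴹ proj i
  proj-idempotent i a b = trans (reflexive (*ᴹ≡·M (proj i) (proj i) a b)) (proj-idem i a b)

  proj-orthogonal : ∀ i j → i ≢ j → proj i *ᴹ proj j ≈ᴹ (λ _ _ → 0#)
  proj-orthogonal i j i≢j a b =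
    trans (reflexive (*ᴹ≡·M (proj i) (proj j) a b)) (proj-orth i j i≢j a b)

  proj-resolution : ∀ a b → sum (λ j → proj j a b) ≈ idM F a b
  proj-resolution a b = trans (reflexive (≡.sym (sumF≡sum (λ j → proj j a b)))) (proj-sum a b)

  eigenprojection : ∀ j → L *ᴹ proj j ≈ᴹ eigval j •ᴹ proj j
  eigenprojection j a b =
    trans (*ᴹ-congˡ (proj j) L≈combination a b)
          (combination-*ᴹ-orthogonal proj-idempotent proj-orthogonal eigval j a b)
    where
    L≈combination : L ≈ᴹ combination eigval proj
    L≈combination a b = trans (decomp a b) (reflexive (sumF≡sum (λ i → eigval i * proj i a b)))

  sum-Lstar-proj : ∀ {a b} → a ≢ b → sum (λ j → Lstar F (proj j) a b) ≈ 1# + 1#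
  sum-Lstar-proj {a} {b} a≢b = begin
    sum (λ j → Lstar F (proj j) a b)              ≈⟨ Lstar-sum proj a b ⟨
    Lstar F (λ u v → sum (λ j → proj j u v)) a b  ≈⟨ Lstar-cong proj-resolution a b ⟩
    Lstar F (idM F) a b                           ≈⟨ Lstar-idM a≢b ⟩
    1# + 1#                                       ∎

sumℕ-zero : ∀ {n} {f : Fin n → ℕ} → (∀ i → f i ≡ 0) → sumℕ f ≡ 0
sumℕ-zero {zero}  _   = ≡.refl
sumℕ-zero {suc n} f≡0 = ≡.cong₂ ℕ._+_ (f≡0 zero) (sumℕ-zero (f≡0 ∘ suc))

module _ {n} (G : Graph n) where

  adjacent⇒distinct : ∀ {a b} → Adj G a b → a ≢ b
  adjacent⇒distinct {a} a~a ≡.refl = ≡.subst T (adj-irr G a) a~a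

  numWalks-suc≡0 : ∀ ℓ {a} b → (∀ c → Adj G a c → numWalks G ℓ c b ≡ 0) →
                   numWalks G (suc ℓ) a b ≡ 0
  numWalks-suc≡0 ℓ {a} b via-neighbours = sumℕ-zero term
    where
    term : ∀ c → adjℕ G a c ℕ.* numWalks G ℓ c b ≡ 0
    term c with adj G a c | via-neighbours c
    ... | false | _    = ≡.refl
    ... | true  | via-c = ≡.trans (ℕ.+-identityʳ _) (via-c tt)

double : ℕ → ℕ
double zero    = zero
double (suc k) = suc (suc (double k))

data EvenOrOdd : ℕ → Set where
  even : ∀ k → EvenOrOdd (double k)
  odd  : ∀ k → EvenOrOdd (suc (double k))

evenOrOdd : ∀ ℓ → EvenOrOdd ℓ
evenOrOdd zero = even zero
evenOrOdd (suc ℓ) with evenOrOdd ℓ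
... | even k = odd k
... | odd  k = even (suc k)

module Bipartite {n} (G : Graph n) {part : Fin n → Bool} (bipartite : Bipartition G part) where

  part-across : ∀ {a b} → part a ≢ part b → part b ≡ not (part a)
  part-across a≢b = ¬-not (a≢b ∘ ≡.sym)

  part-adjacent : ∀ {a b} → Adj G a b → part b ≡ not (part a)
  part-adjacent {a} {b} ab = part-across (bipartite a b ab)

  part-step-within : ∀ {a b c} → Adj G a c → part a ≡ part b → part c ≢ part b
  part-step-within ac a≡b c≡b = not-¬ (≡.sym a≡b) (≡.trans (≡.sym c≡b) (part-adjacent ac))

  part-step-across : ∀ {a b c} → Adj G a c → part a ≢ part b → part c ≡ part b
  part-step-across ac a≢b = ≡.trans (part-adjacent ac) (≡.sym (part-across a≢b))

  mutual
    numWalks-even-across : ∀ k {a b} → part a ≢ part b → numWalks G (double k) a b ≡ 0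
    numWalks-even-across zero {a} {b} a≢b with a ≟ b
    ... | yes ≡.refl = ⊥-elim (a≢b ≡.refl)
    ... | no  _      = ≡.refl
    numWalks-even-across (suc k) {b = b} a≢b = numWalks-suc≡0 G (suc (double k)) b
      (λ c ac → numWalks-odd-within k (part-step-across ac a≢b))

    numWalks-odd-within : ∀ k {a b} → part a ≡ part b → numWalks G (suc (double k)) a b ≡ 0
    numWalks-odd-within k {b = b} a≡b = numWalks-suc≡0 G (double k) b
      (λ c ac → numWalks-even-across k (part-step-within ac a≡b))

  module _ {g₁ g₂} (A : AbelianGroup g₁ g₂) (x : Fin n → AbelianGroup.Carrier A)
           {K : AbelianGroup.Carrier A} where
    open AbelianGroup A
    open import Algebra.Properties.Group group using (∙-cancelʳ)
    open import Relation.Binary.Reasoning.Setoid setoid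

    module _ (edge-sum : ∀ {a b} → Adj G a b → x a ∙ x b ≈ K) where

      edge-sum-along-walk : ∀ {ℓ a b} → Walk G ℓ a b →
        (part a ≡ part b → x a ≈ x b) × (part a ≢ part b → x a ∙ x b ≈ K)
      edge-sum-along-walk here = (λ _ → refl) , (λ a≢a → ⊥-elim (a≢a ≡.refl))
      edge-sum-along-walk {a = a} {b} (step {b = c} ac walk) with edge-sum-along-walk walk
      ... | within-c , across-c = within , across
        where
        within : part a ≡ part b → x a ≈ x b
        within a≡b = ∙-cancelʳ (x c) (x a) (x b) (begin
          x a ∙ x c  ≈⟨ edge-sum ac ⟩
          K          ≈⟨ across-c (part-step-within ac a≡b) ⟨
          x c ∙ x b  ≈⟨ comm (x c) (x b) ⟩
          x b ∙ x c  ∎)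
        across : part a ≢ part b → x a ∙ x b ≈ K
        across a≢b = trans (∙-congˡ (sym (within-c (part-step-across ac a≢b)))) (edge-sum ac)

      constant-on-parts : Connected G → ∀ u v → part u ≡ part v → x u ≈ x v
      constant-on-parts connected u v = proj₁ (edge-sum-along-walk (proj₂ (connected u v)))

  vertex-in-part : HasEdge G → ∀ p → ∃ λ v → part v ≡ p
  vertex-in-part (a , b , ab) p with part a ≟ᴮ p
  ... | yes a∈p = a , a∈p
  ... | no  a∉p = b , ≡.trans (part-adjacent ab) (≡.sym (¬-not (a∉p ∘ ≡.sym)))

  partConstant⇒walkBiregular : HasEdge G →
    (∀ ℓ u v → part u ≡ part v → closedWalks G ℓ u ≡ closedWalks G ℓ v) → WalkBiregular G part
  partConstant⇒walkBiregular edge constant ℓ with vertex-in-part edge false | vertex-in-part edge true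
  ... | v₁ , v₁∈V₁ | v₂ , v₂∈V₂ =
    closedWalks G ℓ v₁ , closedWalks G ℓ v₂ ,
    (λ a a∈V₁ → constant ℓ a v₁ (≡.trans a∈V₁ (≡.sym v₁∈V₁))) ,
    (λ b b∈V₂ → constant ℓ b v₂ (≡.trans b∈V₂ (≡.sym v₂∈V₂)))

module GraphMatrices {c ℓ} (F : OrderedField c ℓ) {n} (G : Graph n) where
  open OrderedField F hiding (zero)
  open Matrices commRing
  open OrderedFieldProperties F
  open FieldMatrices F
  open import Algebra.Properties.Group +-group using (x≈z//y)
  open import Algebra.Properties.Ring ring using ([y-z]x≈yx-zx)
  open import Relation.Binary.Reasoning.Setoid setoid

  adjacencyᶠ : Matrix F n
  adjacencyᶠ a b = fromℕ F (adjℕ G a b)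

  degreeᶠ : Fin n → Carrier
  degreeᶠ a = fromℕ F (degree G a)

  walksᶠ : ℕ → Matrix F n
  walksᶠ m a b = fromℕ F (numWalks G m a b)

  walksᶠ-zero : walksᶠ 0 ≈ᴹ idM F
  walksᶠ-zero a b with a ≟ b
  ... | yes _ = +-identityʳ 1#
  ... | no  _ = refl

  walksᶠ-suc : ∀ m → walksᶠ (suc m) ≈ᴹ adjacencyᶠ *ᴹ walksᶠ m
  walksᶠ-suc m a b = trans (fromℕ-sumℕ (λ k → adjℕ G a k ℕ.* numWalks G m k b))
                           (sum-cong-≋ (λ k → fromℕ-* (adjℕ G a k) (numWalks G m k b)))

  adjacencyᶠ-irreflexive : ∀ a → adjacencyᶠ a a ≈ 0#
  adjacencyᶠ-irreflexive a rewrite adj-irr G a = refl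

  adjacencyᶠ-*-cong : ∀ {a k x y} → (Adj G a k → x ≈ y) → adjacencyᶠ a k * x ≈ adjacencyᶠ a k * y
  adjacencyᶠ-*-cong {a} {k} {x} {y} x≈y with adj G a k | x≈y
  ... | false | _    = trans (zeroˡ x) (sym (zeroˡ y))
  ... | true  | x≈y′ = *-congˡ (x≈y′ tt)

  laplacian+adjacency : ∀ a b → laplacian F G a b + adjacencyᶠ a b ≈ idM F a b * degreeᶠ a
  laplacian+adjacency a b with a ≟ b
  ... | yes ≡.refl = begin
    degreeᶠ a + adjacencyᶠ a a  ≈⟨ +-congˡ (adjacencyᶠ-irreflexive a) ⟩
    degreeᶠ a + 0#              ≈⟨ +-identityʳ (degreeᶠ a) ⟩
    degreeᶠ a                   ≈⟨ *-identityˡ (degreeᶠ a) ⟨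
    1# * degreeᶠ a              ∎
  ... | no _ with adj G a b
  ...   | true  = trans (+-congˡ (+-identityʳ 1#)) (trans (-‿inverseˡ 1#) (sym (zeroˡ (degreeᶠ a))))
  ...   | false = trans (+-identityˡ 0#) (sym (zeroˡ (degreeᶠ a)))

  laplacian-*ᴹ+adjacency-*ᴹ : ∀ Y a b →
    (laplacian F G *ᴹ Y) a b + (adjacencyᶠ *ᴹ Y) a b ≈ degreeᶠ a * Y a b
  laplacian-*ᴹ+adjacency-*ᴹ Y a b = begin
    sum (λ k → L a k * Y k b) + sum (λ k → adjacencyᶠ a k * Y k b)
      ≈⟨ ∑-distrib-+ (λ k → L a k * Y k b) (λ k → adjacencyᶠ a k * Y k b) ⟨
    sum (λ k → L a k * Y k b + adjacencyᶠ a k * Y k b)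
      ≈⟨ sum-cong-≋ (λ k → distribʳ (Y k b) (L a k) (adjacencyᶠ a k)) ⟨
    sum (λ k → (L a k + adjacencyᶠ a k) * Y k b)
      ≈⟨ sum-cong-≋ (λ k → *-congʳ (laplacian+adjacency a k)) ⟩
    sum (λ k → idM F a k * degreeᶠ a * Y k b)
      ≈⟨ sum-single a _ (λ k k≢a → trans (*-congʳ (trans (*-congʳ (idM-offDiagonal (k≢a ∘ ≡.sym)))
                                                          (zeroˡ (degreeᶠ a))))
                                         (zeroˡ (Y k b))) ⟩
    idM F a a * degreeᶠ a * Y a b
      ≈⟨ *-congʳ (trans (*-congʳ (idM-diagonal a)) (*-identityˡ (degreeᶠ a))) ⟩
    degreeᶠ a * Y a b ∎
    where
    L : Matrix F n
    L = laplacian F G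

  adjacency-*ᴹ-eigenvector : ∀ {Y θ} → laplacian F G *ᴹ Y ≈ᴹ θ •ᴹ Y →
    ∀ a b → (adjacencyᶠ *ᴹ Y) a b ≈ (degreeᶠ a - θ) * Y a b
  adjacency-*ᴹ-eigenvector {Y} {θ} LY≈θY a b = begin
    (adjacencyᶠ *ᴹ Y) a b          ≈⟨ x≈z//y _ _ _ AY+θY≈dY ⟩
    degreeᶠ a * Y a b - θ * Y a b  ≈⟨ [y-z]x≈yx-zx (Y a b) (degreeᶠ a) θ ⟨
    (degreeᶠ a - θ) * Y a b        ∎
    where
    AY+θY≈dY : (adjacencyᶠ *ᴹ Y) a b + θ * Y a b ≈ degreeᶠ a * Y a b
    AY+θY≈dY = trans (+-comm _ _)
      (trans (+-congʳ (sym (LY≈θY a b))) (laplacian-*ᴹ+adjacency-*ᴹ Y a b))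

  EdgeConstant : Matrix F n → Set (c ⊔ ℓ)
  EdgeConstant X = ∃ λ κ → ∀ a b → Adj G a b → Lstar F X a b ≈ κ

  edgeConstant-cong : ∀ {X Y} → X ≈ᴹ Y → EdgeConstant Y → EdgeConstant X
  edgeConstant-cong X≈Y (κ , LY≈κ) = κ , λ a b ab → trans (Lstar-cong X≈Y a b) (LY≈κ a b ab)

  edgeConstant-combination : ∀ {r} x (X : Fin r → Matrix F n) →
    (∀ j → EdgeConstant (X j)) → EdgeConstant (combination x X)
  edgeConstant-combination x X const = sum (λ j → x j * proj₁ (const j)) , λ a b ab →
    trans (Lstar-combination x X a b) (sum-cong-≋ (λ j → *-congˡ (proj₂ (const j) a b ab)))

module BipartiteBiregular {c ℓ} (F : OrderedField c ℓ) {n} (G : Graph n) {part : Fin n → Bool}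
  {d₁ d₂ : ℕ} (bipartite : Bipartition G part) (biregular : Biregular G part d₁ d₂) where
  open OrderedField F hiding (zero)
  open Matrices commRing
  open GraphMatrices F G
  open Bipartite G bipartite
  open import Algebra.Properties.CommutativeSemigroup *-commutativeSemigroup
    using (x∙yz≈y∙xz)
  open import Relation.Binary.Reasoning.Setoid setoid

  sideDegree : Bool → Carrier
  sideDegree false = fromℕ F d₁
  sideDegree true  = fromℕ F d₂

  degreeᶠ-side : ∀ a → degreeᶠ a ≈ sideDegree (part a)
  degreeᶠ-side a with part a | proj₁ biregular a | proj₂ biregular a
  ... | false | deg≡d₁ | _      = reflexive (≡.cong (fromℕ F) (deg≡d₁ ≡.refl))
  ... | true  | _      | deg≡d₂ = reflexive (≡.cong (fromℕ F) (deg≡d₂ ≡.refl))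

  degreeᶠ-neighbour : ∀ {a k} → Adj G a k → degreeᶠ k ≈ sideDegree (not (part a))
  degreeᶠ-neighbour {a} {k} ak =
    trans (degreeᶠ-side k) (reflexive (≡.cong sideDegree (part-adjacent ak)))

  adjacency²-eigenvector : ∀ {Y θ} → (∀ a b → (adjacencyᶠ *ᴹ Y) a b ≈ (degreeᶠ a - θ) * Y a b) →
    adjacencyᶠ *ᴹ (adjacencyᶠ *ᴹ Y) ≈ᴹ ((fromℕ F d₁ - θ) * (fromℕ F d₂ - θ)) •ᴹ Y
  adjacency²-eigenvector {Y} {θ} AY≈ a b = begin
    sum (λ k → A a k * (A *ᴹ Y) k b)
      ≈⟨ sum-cong-≋ (λ k → *-congˡ (AY≈ k b)) ⟩
    sum (λ k → A a k * ((degreeᶠ k - θ) * Y k b))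
      ≈⟨ sum-cong-≋ via-opposite-side ⟩
    sum (λ k → (d′ - θ) * (A a k * Y k b))
      ≈⟨ *-distribˡ-sum (d′ - θ) (λ k → A a k * Y k b) ⟨
    (d′ - θ) * (A *ᴹ Y) a b
      ≈⟨ *-congˡ (AY≈ a b) ⟩
    (d′ - θ) * ((degreeᶠ a - θ) * Y a b)
      ≈⟨ *-assoc (d′ - θ) (degreeᶠ a - θ) (Y a b) ⟨
    (d′ - θ) * (degreeᶠ a - θ) * Y a b
      ≈⟨ *-congʳ (trans (*-congˡ (+-congʳ (degreeᶠ-side a))) (sides (part a))) ⟩
    (fromℕ F d₁ - θ) * (fromℕ F d₂ - θ) * Y a b   ∎
    where
    A : Matrix F n
    A = adjacencyᶠ
    d′ : Carrier
    d′ = sideDegree (not (part a))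
    via-opposite-side : ∀ k → A a k * ((degreeᶠ k - θ) * Y k b) ≈ (d′ - θ) * (A a k * Y k b)
    via-opposite-side k = trans (adjacencyᶠ-*-cong (λ ak → *-congʳ (+-congʳ (degreeᶠ-neighbour ak))))
                                (x∙yz≈y∙xz (A a k) (d′ - θ) (Y k b))
    sides : ∀ p → (sideDegree (not p) - θ) * (sideDegree p - θ) ≈
                  (fromℕ F d₁ - θ) * (fromℕ F d₂ - θ)
    sides false = *-comm (fromℕ F d₂ - θ) (fromℕ F d₁ - θ)
    sides true  = refl

  module _ (S : SpectralDecomposition F (laplacian F G)) where
    open SpectralDecomposition S
    open SpectralDecompositionProperties F S
    open OrderedFieldProperties F
    open FieldMatrices F
    open import Algebra.Properties.Semiring.Exp semiring using (_^_)
    open import Algebra.Properties.Group +-group using (x≈z//y)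
    open import Algebra.Properties.CommutativeSemigroup *-commutativeSemigroup
      using (x∙yz≈yx∙z)

    μ : Fin r → Carrier
    μ j = (fromℕ F d₁ - eigval j) * (fromℕ F d₂ - eigval j)

    walksᶠ-even : ∀ k → walksᶠ (double k) ≈ᴹ combination (λ j → μ j ^ k) proj
    walksᶠ-even zero a b = trans (walksᶠ-zero a b)
      (sym (trans (sum-cong-≋ (λ j → *-identityˡ (proj j a b))) (proj-resolution a b)))
    walksᶠ-even (suc k) a b = begin
      walksᶠ (suc (suc (double k))) a b
        ≈⟨ walksᶠ-suc (suc (double k)) a b ⟩
      (adjacencyᶠ *ᴹ walksᶠ (suc (double k))) a b
        ≈⟨ *ᴹ-congʳ adjacencyᶠ (walksᶠ-suc (double k)) a b ⟩
      (adjacencyᶠ *ᴹ (adjacencyᶠ *ᴹ walksᶠ (double k))) a b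
        ≈⟨ *ᴹ-congʳ adjacencyᶠ (*ᴹ-congʳ adjacencyᶠ (walksᶠ-even k)) a b ⟩
      (adjacencyᶠ *ᴹ (adjacencyᶠ *ᴹ combination μᵏ proj)) a b
        ≈⟨ *ᴹ-congʳ adjacencyᶠ (*ᴹ-distribˡ-combination adjacencyᶠ μᵏ proj) a b ⟩
      (adjacencyᶠ *ᴹ combination μᵏ (λ j → adjacencyᶠ *ᴹ proj j)) a b
        ≈⟨ *ᴹ-distribˡ-combination adjacencyᶠ μᵏ (λ j → adjacencyᶠ *ᴹ proj j) a b ⟩
      sum (λ j → μ j ^ k * (adjacencyᶠ *ᴹ (adjacencyᶠ *ᴹ proj j)) a b)
        ≈⟨ sum-cong-≋ (λ j → *-congˡ (adjacency²-proj j a b)) ⟩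
      sum (λ j → μ j ^ k * (μ j * proj j a b))
        ≈⟨ sum-cong-≋ (λ j → x∙yz≈yx∙z (μ j ^ k) (μ j) (proj j a b)) ⟩
      sum (λ j → μ j ^ suc k * proj j a b) ∎
      where
      μᵏ : Fin r → Carrier
      μᵏ j = μ j ^ k
      adjacency²-proj : ∀ j → adjacencyᶠ *ᴹ (adjacencyᶠ *ᴹ proj j) ≈ᴹ μ j •ᴹ proj j
      adjacency²-proj j = adjacency²-eigenvector (adjacency-*ᴹ-eigenvector (eigenprojection j))

    -- Edge-rigidity says nothing about E₀:
    -- 𝓛*(E₀) is determined by the others through Σⱼ Eⱼ = I.
    edgeRigid⇒edgeConstant : EdgeRigid F G S → ∀ j → EdgeConstant (proj j)
    edgeRigid⇒edgeConstant rigid (suc j) with rigid (suc j) (λ ())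
    ... | γ , _ , Lstar≈γ = γ , Lstar≈γ
    edgeRigid⇒edgeConstant rigid zero =
      (1# + 1#) - sum (λ j → proj₁ (rigid (suc j) λ ())) , λ a b ab → begin
        Lstar F (proj zero) a b
          ≈⟨ x≈z//y _ _ _ (sum-Lstar-proj (adjacent⇒distinct G ab)) ⟩
        (1# + 1#) - sum (λ j → Lstar F (proj (suc j)) a b)
          ≈⟨ +-congˡ (-‿cong (sum-cong-≋ (λ j → proj₂ (proj₂ (rigid (suc j) λ ())) a b ab))) ⟩
        (1# + 1#) - sum (λ j → proj₁ (rigid (suc j) λ ())) ∎

    closedWalks-even-edge-sum : EdgeRigid F G S → ∀ k → ∃ λ κ → ∀ {a b} → Adj G a b →
      walksᶠ (double k) a a + walksᶠ (double k) b b ≈ κ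
    closedWalks-even-edge-sum rigid k with edgeConstant-cong (walksᶠ-even k)
      (edgeConstant-combination (λ j → μ j ^ k) proj (edgeRigid⇒edgeConstant rigid))
    ... | κ , Lstar≈κ = κ , λ {a} {b} ab → trans
      (sym (Lstar-zero-entry (walksᶠ (double k))
             (reflexive (≡.cong (fromℕ F) (numWalks-even-across k (bipartite a b ab))))))
      (Lstar≈κ a b ab)

    closedWalks-part-constant : Connected G → EdgeRigid F G S →
      ∀ ℓ u v → part u ≡ part v → closedWalks G ℓ u ≡ closedWalks G ℓ v
    closedWalks-part-constant connected rigid ℓ u v u~v with evenOrOdd ℓ
    ... | even k = fromℕ-injective (constant-on-parts +-abelianGroup (λ a → walksᶠ (double k) a a)
                     (proj₂ (closedWalks-even-edge-sum rigid k)) connected u v u~v)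
    ... | odd k = ≡.trans (numWalks-odd-within k ≡.refl) (≡.sym (numWalks-odd-within k ≡.refl))

mainTheorem13 : ∀ {c ℓ} (F : OrderedField c ℓ) (n : ℕ) (G : Graph n)
    (part : Fin n → Bool) (d₁ d₂ : ℕ) →
    Bipartition G part → Biregular G part d₁ d₂ → Connected G → HasEdge G →
    (S : SpectralDecomposition F (laplacian F G)) → EdgeRigid F G S →
    WalkBiregular G part
mainTheorem13 F n G part d₁ d₂ bipartite biregular connected edge S rigid =
  Bipartite.partConstant⇒walkBiregular G bipartite edge
    (BipartiteBiregular.closedWalks-part-constant F G bipartite biregular S connected rigid)
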